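{- Let $a\ge 3$ be an integer and $m=a^2-a+1$. Then every coloring of $[C(m,a)]=\{1,\dots,C(m,a)\}$ with two colors yields a monochromatic solution of $x_1+x_2+\cdots+x_{m-1}=ax_m$, i.e., there exist $x_1,\dots,x_m\in[C(m,a)]$, not necessarily distinct, all of the same color, satisfying the equation. Here $C(m,a)=\left\lceil\frac{m-1}{a}\left\lceil\frac{m-1}{a}\right\rceil\right\rceil$. -}

module Defs where

open import Data.Nat using (ℕ; suc; _+_; _*_; _∸_; _/_; NonZero)
open import Data.Fin using (Fin)
open import Data.Vec.Functional using (Vector)
open import Data.Vec.Functional using (foldr)

⌈_/_⌉ : (n d : ℕ) → .{{NonZero d}} → ℕ
⌈ n / d ⌉ = (n + d ∸ 1) / d

-- C(m,a) = ⌈ ((m-1)/a) * ⌈ (m-1)/a ⌉ ⌉  =  ⌈ ((m-1) * ⌈(m-1)/a⌉) / a ⌉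
C : (m a : ℕ) → .{{NonZero a}} → ℕ
C m a = ⌈ (m ∸ 1) * ⌈ m ∸ 1 / a ⌉ / a ⌉

∑ : {n : ℕ} → (Fin n → ℕ) → ℕ
∑ {n} f = foldr _+_ 0 f

-- Write n = a − 1, so that m − 1 = n·a and C(m, a) = n².  Of the three numbers 1, n, n²
-- two receive the same colour (written x ~ y), and each such pair yields a solution:
--   1 ~ n  : n·a copies of 1 sum to a·n;
--   n ~ n² : n·a copies of n sum to a·n²;
--   1 ~ n² : n copies of n² and n² copies of 1 sum to n³ + n² = a·n².
module Submission where

open import Defs
open import Data.Nat using (ℕ; zero; suc; _+_; _*_; _∸_; _/_; _≤_; _<ᵇ_; NonZero; z≤n; s≤s; >-nonZero⁻¹)
open import Data.Nat.Properties
open import Data.Nat.DivMod using (+-distrib-/-∣ˡ; m*n/n≡m; m<n⇒m/n≡0)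
open import Data.Nat.Divisibility using (n∣m*n)
open import Data.Fin using (Fin; toℕ)
open import Data.Bool using (Bool; true; false; if_then_else_)
open import Data.Product using (Σ; _×_; _,_)
open import Data.Sum using (_⊎_; inj₁; inj₂)
open import Relation.Binary.PropositionalEquality
open ≡-Reasoning

⌈m*n/n⌉≡m : ∀ m n .{{_ : NonZero n}} → ⌈ m * n / n ⌉ ≡ m
⌈m*n/n⌉≡m m n@(suc n-1) = begin
  (m * n + n ∸ 1) / n       ≡⟨ cong (_/ n) (+-∸-assoc (m * n) (s≤s z≤n)) ⟩
  (m * n + n-1) / n         ≡⟨ +-distrib-/-∣ˡ n-1 (n∣m*n m) ⟩
  m * n / n + n-1 / n       ≡⟨ cong₂ _+_ (m*n/n≡m m n) (m<n⇒m/n≡0 (n<1+n n-1)) ⟩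
  m + 0                     ≡⟨ +-identityʳ m ⟩
  m                         ∎

∑-const : ∀ k c → ∑ {k} (λ _ → c) ≡ k * c
∑-const zero    c = refl
∑-const (suc k) c = cong (c +_) (∑-const k c)

blocks : ∀ {k} → ℕ → ℕ → ℕ → Fin k → ℕ
blocks p c d i = if toℕ i <ᵇ p then c else d

∑-blocks : ∀ p q c d → ∑ {p + q} (blocks p c d) ≡ p * c + q * d
∑-blocks zero    q c d = ∑-const q d
∑-blocks (suc p) q c d = begin
  c + ∑ {p + q} (blocks p c d) ≡⟨ cong (c +_) (∑-blocks p q c d) ⟩
  c + (p * c + q * d)          ≡⟨ +-assoc c (p * c) (q * d) ⟨
  suc p * c + q * d            ∎

blocks-preserves : ∀ (P : ℕ → Set) {k} p {c d} → P c → P d → (i : Fin k) → P (blocks p c d i)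
blocks-preserves P p Pc Pd i with toℕ i <ᵇ p
... | true  = Pc
... | false = Pd

pigeonhole : ∀ (b c d : Bool) → b ≡ c ⊎ c ≡ d ⊎ b ≡ d
pigeonhole false false _     = inj₁ refl
pigeonhole true  true  _     = inj₁ refl
pigeonhole _     false false = inj₂ (inj₁ refl)
pigeonhole _     true  true  = inj₂ (inj₁ refl)
pigeonhole false true  false = inj₂ (inj₂ refl)
pigeonhole true  false true  = inj₂ (inj₂ refl)

Admissible : ℕ → (ℕ → Bool) → ℕ → ℕ → Set
Admissible N col xm x = 1 ≤ x × x ≤ N × col x ≡ col xm

MonochromaticSolution : (k a N : ℕ) → (ℕ → Bool) → Set
MonochromaticSolution k a N col =
  Σ (Fin k → ℕ) λ x → Σ ℕ λ xm →
    (∀ i → Admissible N col xm (x i)) × 1 ≤ xm × xm ≤ N × ∑ {k} x ≡ a * xm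

constant-solution : ∀ {a N col} k c xm → Admissible N col xm c → 1 ≤ xm → xm ≤ N →
                    k * c ≡ a * xm → MonochromaticSolution k a N col
constant-solution k c xm c-ok 1≤xm xm≤N sum≡ =
  (λ _ → c) , xm , (λ _ → c-ok) , 1≤xm , xm≤N , trans (∑-const k c) sum≡

blocks-solution : ∀ {k a N col} p q c d xm → k ≡ p + q →
                  Admissible N col xm c → Admissible N col xm d → 1 ≤ xm → xm ≤ N →
                  p * c + q * d ≡ a * xm → MonochromaticSolution k a N col
blocks-solution {col = col} p q c d xm refl c-ok d-ok 1≤xm xm≤N sum≡ =
  blocks p c d , xm , blocks-preserves (Admissible _ col xm) p c-ok d-ok ,
  1≤xm , xm≤N , trans (∑-blocks p q c d) sum≡

m∸1≡n*a : ∀ n → suc n * suc n ∸ suc n + 1 ∸ 1 ≡ n * suc n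
m∸1≡n*a n = begin
  suc n * suc n ∸ suc n + 1 ∸ 1 ≡⟨ m+n∸n≡m _ 1 ⟩
  suc n * suc n ∸ suc n         ≡⟨⟩
  suc n + n * suc n ∸ suc n     ≡⟨ m+n∸m≡n (suc n) (n * suc n) ⟩
  n * suc n                     ∎

C≡n² : ∀ n → C (suc n * suc n ∸ suc n + 1) (suc n) ≡ n * n
C≡n² n = begin
  ⌈ (m ∸ 1) * ⌈ m ∸ 1 / a ⌉ / a ⌉ ≡⟨ cong (λ k → ⌈ k * ⌈ k / a ⌉ / a ⌉) (m∸1≡n*a n) ⟩
  ⌈ n * a * ⌈ n * a / a ⌉ / a ⌉   ≡⟨ cong (λ c → ⌈ n * a * c / a ⌉) (⌈m*n/n⌉≡m n a) ⟩
  ⌈ n * a * n / a ⌉               ≡⟨ cong ⌈_/ a ⌉ (*-comm (n * a) n) ⟩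
  ⌈ n * (n * a) / a ⌉             ≡⟨ cong ⌈_/ a ⌉ (*-assoc n n a) ⟨
  ⌈ n * n * a / a ⌉               ≡⟨ ⌈m*n/n⌉≡m (n * n) a ⟩
  n * n                           ∎
  where
  a = suc n
  m = a * a ∸ a + 1

monochromatic-solution : ∀ n .{{_ : NonZero n}} (col : ℕ → Bool) →
                         MonochromaticSolution (n * suc n) (suc n) (n * n) col
monochromatic-solution n col = from-equal-colours (pigeonhole (col 1) (col n) (col (n * n)))
  where
  1≤n : 1 ≤ n
  1≤n = >-nonZero⁻¹ n
  n≤n² : n ≤ n * n
  n≤n² = m≤m*n n n
  1≤n² : 1 ≤ n * n
  1≤n² = ≤-trans 1≤n n≤n²

  from-equal-colours : col 1 ≡ col n ⊎ col n ≡ col (n * n) ⊎ col 1 ≡ col (n * n) →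
                       MonochromaticSolution (n * suc n) (suc n) (n * n) col
  from-equal-colours (inj₁ 1~n) =
    constant-solution {a = suc n} (n * suc n) 1 n (≤-refl , 1≤n² , 1~n) 1≤n n≤n²
      (trans (*-identityʳ (n * suc n)) (*-comm n (suc n)))
  from-equal-colours (inj₂ (inj₁ n~n²)) =
    constant-solution {a = suc n} (n * suc n) n (n * n) (1≤n , n≤n² , n~n²) 1≤n² ≤-refl
      (trans (cong (_* n) (*-comm n (suc n))) (*-assoc (suc n) n n))
  from-equal-colours (inj₂ (inj₂ 1~n²)) =
    blocks-solution {a = suc n} n (n * n) (n * n) 1 (n * n) (*-suc n n)
      (1≤n² , ≤-refl , refl) (≤-refl , 1≤n² , 1~n²) 1≤n² ≤-refl
      (trans (cong (n * (n * n) +_) (*-identityʳ (n * n))) (+-comm (n * (n * n)) (n * n)))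

-- The hypothesis a ≥ 3 is stronger than needed: the argument works for every a ≥ 2.
proposition1 : (a : ℕ) → 3 ≤ a → .{{_ : NonZero a}} →
    let m = a * a ∸ a + 1 in
    (col : ℕ → Bool) →
    Σ (Fin (m ∸ 1) → ℕ) λ x → Σ ℕ λ xm →
      ((∀ i → 1 ≤ x i × x i ≤ C m a × col (x i) ≡ col xm)
       × 1 ≤ xm × xm ≤ C m a
       × ∑ {m ∸ 1} x ≡ a * xm)
proposition1 (suc n) (s≤s (s≤s _)) col =
  subst₂ (λ k N → MonochromaticSolution k (suc n) N col)
    (sym (m∸1≡n*a n)) (sym (C≡n² n)) (monochromatic-solution n col)
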